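{- For every positive integer $n$, the formula $\mathrm{Ordering}_n$ is $(n-2)$-extensible with respect to $\mathrm{ORDER}_n$.
   Context: $\mathrm{Ordering}_n$ is the CNF in the variables $(x_{ij})_{i\neq j\in[n]}$ (intended meaning: element $i$ precedes element $j$) consisting of the clauses: anti-symmetry $\neg x_{ij}\lor\neg x_{ji}$ for all $i\neq j$; totality $x_{ij}\lor x_{ji}$ for all $i\ne j$; transitivity $\neg x_{ij}\lor\neg x_{jk}\lor x_{ik}$ for all distinct $i,j,k$; non-minimality $NM_i = \bigvee_{j\in[n]\setminus\{i\}} x_{ji}$ for all $i\in[n]$. $\mathrm{ORDER}_n$ is the set of anti-symmetry, totality and transitivity clauses. A CNF is viewed as a linear CNF by writing literal $x$ as $(x=1)$ and $\neg x$ as $(x=0)$. For a linear CNF $\phi$ in variables $v$ and $F\subseteq\phi$, a solution of a linear system $Av=b$ over $\mathbb{F}_2$ is $F$-proper if it satisfies every clause of $F$; $\phi$ is $m$-extensible with respect to $F$ if for every linear system $Av=b$ over $\mathbb{F}_2$ in the variables $v$ with fewer than $m$ equations that has an $F$-proper solution, and every clause $C\in\phi\setminus F$, there is an $F$-proper solution of $Av=b$ satisfying $C$. -}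

module Defs where

open import Data.Bool using (Bool; true; false; _∧_; _xor_; if_then_else_)
open import Data.Nat using (ℕ; _<_)
open import Data.Fin using (Fin)
open import Data.Fin.Properties using (_≟_)
open import Data.List using (List; []; _∷_; foldr; map; filter; length; cartesianProduct; allFin)
open import Data.List.Relation.Unary.All using (All)
open import Data.List.Relation.Unary.Any using (Any)
open import Data.Product using (Σ; _×_; _,_; proj₁; proj₂; ∃)
open import Relation.Nullary using (¬_; ¬?)
open import Relation.Nullary.Decidable using (⌊_⌋)
open import Relation.Binary.PropositionalEquality using (_≡_; _≢_)
open import Data.Product.Properties using (≡-dec)

-- Generic linear CNFs over F₂ (F₂ = Bool, + = xor, · = ∧).
-- Variables range over a type V; the variables actually present are
-- those in the list `vars` (summation is over this list).

record LinEq (V : Set) : Set where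
  constructor linEq
  field
    coeff : V → Bool
    rhs   : Bool
open LinEq public

Assignment : Set → Set
Assignment V = V → Bool

evalLin : {V : Set} → List V → (V → Bool) → Assignment V → Bool
evalLin vars a α = foldr (λ v acc → (a v ∧ α v) xor acc) false vars

SatEq : {V : Set} → List V → Assignment V → LinEq V → Set
SatEq vars α e = evalLin vars (coeff e) α ≡ rhs e

LinSystem : Set → Set
LinSystem V = List (LinEq V)

SolvesSystem : {V : Set} → List V → Assignment V → LinSystem V → Set
SolvesSystem vars α S = All (SatEq vars α) S

LinClause : Set → Set
LinClause V = List (LinEq V)

SatClause : {V : Set} → List V → Assignment V → LinClause V → Set
SatClause vars α C = Any (SatEq vars α) C

LinCNF : Set → Set₁
LinCNF V = LinClause V → Set

Proper : {V : Set} → List V → LinCNF V → Assignment V → Set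
Proper vars F α = ∀ C → F C → SatClause vars α C

Extensible : {V : Set} → List V → (φ F : LinCNF V) → ℕ → Set
Extensible {V} vars φ F m =
  (S : LinSystem V) → length S < m →
  (∃ λ α → SolvesSystem vars α S × Proper vars F α) →
  (C : LinClause V) → φ C → ¬ F C →
  ∃ λ α → SolvesSystem vars α S × Proper vars F α × SatClause vars α C

-- The ordering principle.  Variables x_ij are pairs (i , j) with i ≢ j.

OVar : ℕ → Set
OVar n = Fin n × Fin n

offDiag : (n : ℕ) → List (OVar n)
offDiag n = filter (λ p → ¬? (proj₁ p ≟ proj₂ p)) (cartesianProduct (allFin n) (allFin n))

lit : {n : ℕ} → Fin n → Fin n → Bool → LinEq (OVar n)
lit {n} i j b = linEq (λ p → if ⌊ ≡-dec _≟_ _≟_ p (i , j) ⌋ then true else false) b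

pos neg : {n : ℕ} → Fin n → Fin n → LinEq (OVar n)
pos i j = lit i j true
neg i j = lit i j false

data ORDER (n : ℕ) : LinCNF (OVar n) where
  antisym : (i j : Fin n) → i ≢ j → ORDER n (neg i j ∷ neg j i ∷ [])
  total   : (i j : Fin n) → i ≢ j → ORDER n (pos i j ∷ pos j i ∷ [])
  trans   : (i j k : Fin n) → i ≢ j → j ≢ k → i ≢ k →
            ORDER n (neg i j ∷ neg j k ∷ pos i k ∷ [])

NM : {n : ℕ} → Fin n → LinClause (OVar n)
NM {n} i = map (λ j → pos j i) (filter (λ j → ¬? (j ≟ i)) (allFin n))

data Ordering (n : ℕ) : LinCNF (OVar n) where
  order : (C : LinClause (OVar n)) → ORDER n C → Ordering n C
  nonmin : (i : Fin n) → Ordering n (NM i)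

-- Let α be a linear order solving S, and i any element.  Marking a set T of elements by
-- t : Fin n → F₂, promote α t flips each x_ab whose α-later element is marked: it lists T
-- first, in reversed order, then the rest in α-order, so it is again a linear order, and it
-- satisfies NM_i as soon as i ∉ T ≠ ∅.  As promote α t = α ⊕ (t ∘ later α), it still solves
-- an equation of S iff a linear form in t vanishes.  These |S| forms together with t ↦ t i
-- are fewer than n (only |S| < n − 1 is needed), so they have a common nonzero root.
module Submission where

open import Defs renaming (trans to transitivity)
open import Algebra.Bundles using (CommutativeRing)
open import Data.Bool using (Bool; true; false; not; _∧_; _xor_; if_then_else_)
open import Data.Bool.Properties
  using ( xor-identityʳ; not-distribˡ-xor; not-involutive; ∧-distribˡ-xor; xor-∧-commutativeRing
        ; if-not; ¬-not)
  renaming (_≟_ to _≟ᵇ_)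
open CommutativeRing xor-∧-commutativeRing using (+-commutativeSemigroup)
open import Algebra.Properties.CommutativeSemigroup +-commutativeSemigroup using (interchange)
open import Data.Fin using (Fin; zero; suc)
open import Data.Fin.Properties using (_≟_)
open import Data.List using (List; []; _∷_; map; length)
open import Data.List.Properties using (length-map; length-removeAt′)
open import Data.List.Membership.Propositional using (_∈_; _∉_; lose)
open import Data.List.Membership.Propositional.Properties
  using (∈-map⁺; ∈-filter⁺; ∈-cartesianProduct⁺; ∈-allFin)
open import Data.List.Relation.Unary.All as All using (All; []; _∷_)
open import Data.List.Relation.Unary.All.Properties using (map⁺; map⁻; ─⁺; ─⁻; ¬Any⇒All¬)
open import Data.List.Relation.Unary.Any as Any using (here; there; any?; _─_)
open import Data.List.Relation.Unary.Unique.Propositional using (Unique)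
open import Data.List.Relation.Unary.Unique.Propositional.Properties
  using (filter⁺; cartesianProduct⁺; allFin⁺; Unique[x∷xs]⇒x∉xs)
import Data.List.Relation.Unary.AllPairs as AllPairs
open import Data.Nat using (ℕ; _≤_; _<_; _∸_; s<s; s<s⁻¹)
open import Data.Nat.Properties using (m<n⇒m<1+n)
open import Data.Product using (_×_; _,_; proj₁; proj₂; ∃)
open import Data.Product.Properties using (≡-dec)
open import Data.Vec.Functional using (Vector; replicate) renaming (_∷_ to _◂_)
open import Function using (_∘_)
open import Relation.Nullary using (yes; no; contradiction)
open import Relation.Binary.PropositionalEquality
  using (_≡_; _≢_; _≗_; refl; sym; trans; cong; cong₂; subst; ≢-sym; module ≡-Reasoning)

private
  variable
    A B V : Set
    n r : ℕ

infixl 6 _⊕_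

_⊕_ : (A → Bool) → (A → Bool) → A → Bool
(f ⊕ g) x = f x xor g x

record IsLinear (Φ : (A → Bool) → Bool) : Set where
  field
    homo : ∀ f g → Φ (f ⊕ g) ≡ Φ f xor Φ g
    resp : ∀ {f g} → f ≗ g → Φ f ≡ Φ g

record IsLinearMap (h : (A → Bool) → (B → Bool)) : Set where
  field
    homo : ∀ f g → h (f ⊕ g) ≗ h f ⊕ h g
    resp : ∀ {f g} → f ≗ g → h f ≗ h g

∘-isLinear : {Φ : (B → Bool) → Bool} {h : (A → Bool) → (B → Bool)} →
             IsLinear Φ → IsLinearMap h → IsLinear (Φ ∘ h)
∘-isLinear lin hlin = record
  { homo = λ f g → trans (IsLinear.resp lin (IsLinearMap.homo hlin f g)) (IsLinear.homo lin _ _)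
  ; resp = λ f≗g → IsLinear.resp lin (IsLinearMap.resp hlin f≗g)
  }

precompose-isLinearMap : (g : B → A) → IsLinearMap (λ (f : A → Bool) → f ∘ g)
precompose-isLinearMap g = record { homo = λ _ _ _ → refl ; resp = λ f≗f′ → f≗f′ ∘ g }

evaluate-isLinear : (x : A) → IsLinear (λ (f : A → Bool) → f x)
evaluate-isLinear x = record { homo = λ _ _ → refl ; resp = λ f≗g → f≗g x }

evalLin-isLinear : (vs : List V) (a : V → Bool) → IsLinear (evalLin vs a)
evalLin-isLinear vs a = record { homo = homo vs ; resp = resp vs }
  where
    open ≡-Reasoning
    homo : ∀ vs f g → evalLin vs a (f ⊕ g) ≡ evalLin vs a f xor evalLin vs a g
    homo [] f g = refl
    homo (v ∷ vs) f g = begin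
      (a v ∧ (f v xor g v)) xor evalLin vs a (f ⊕ g)
        ≡⟨ cong₂ _xor_ (∧-distribˡ-xor (a v) (f v) (g v)) (homo vs f g) ⟩
      ((a v ∧ f v) xor (a v ∧ g v)) xor (evalLin vs a f xor evalLin vs a g)
        ≡⟨ interchange (a v ∧ f v) (a v ∧ g v) (evalLin vs a f) (evalLin vs a g) ⟩
      ((a v ∧ f v) xor evalLin vs a f) xor ((a v ∧ g v) xor evalLin vs a g) ∎
    resp : ∀ vs {f g} → f ≗ g → evalLin vs a f ≡ evalLin vs a g
    resp []       f≗g = refl
    resp (v ∷ vs) f≗g = cong₂ (λ x y → (a v ∧ x) xor y) (f≗g v) (resp vs f≗g)

e₀ : Vector Bool (ℕ.suc r)
e₀ = true ◂ replicate _ false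

module Hyperplane {Φ : Vector Bool (ℕ.suc r) → Bool} (lin : IsLinear Φ) (Φe₀ : Φ e₀ ≡ true) where

  Φ-true◂ : ∀ t → Φ (true ◂ t) ≡ not (Φ (false ◂ t))
  Φ-true◂ t = begin
    Φ (true ◂ t)                ≡⟨ IsLinear.resp lin (λ { zero → refl ; (suc _) → refl }) ⟩
    Φ (e₀ ⊕ (false ◂ t))        ≡⟨ IsLinear.homo lin e₀ (false ◂ t) ⟩
    Φ e₀ xor Φ (false ◂ t)      ≡⟨ cong (_xor Φ (false ◂ t)) Φe₀ ⟩
    not (Φ (false ◂ t))         ∎
    where open ≡-Reasoning

  embed : Vector Bool r → Vector Bool (ℕ.suc r)
  embed t = Φ (false ◂ t) ◂ t

  Φ∘embed≡false : ∀ t → Φ (embed t) ≡ false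
  Φ∘embed≡false t with Φ (false ◂ t) in eq
  ... | false = eq
  ... | true  = trans (Φ-true◂ t) (cong not eq)

  embed-isLinearMap : IsLinearMap embed
  embed-isLinearMap = record { homo = homo ; resp = resp }
    where
      homo : ∀ t u → embed (t ⊕ u) ≗ embed t ⊕ embed u
      homo t u zero    = trans (IsLinear.resp lin (λ { zero → refl ; (suc _) → refl }))
                               (IsLinear.homo lin (false ◂ t) (false ◂ u))
      homo t u (suc _) = refl
      resp : ∀ {t u} → t ≗ u → embed t ≗ embed u
      resp t≗u zero    = IsLinear.resp lin (λ { zero → refl ; (suc k) → t≗u k })
      resp t≗u (suc k) = t≗u k

NonzeroCommonRoot : List (Vector Bool r → Bool) → Set
NonzeroCommonRoot {r} Φs =
  ∃ λ (t : Vector Bool r) → (∃ λ k → t k ≡ true) × All (λ Φ → Φ t ≡ false) Φs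

-- Either e₀ is a common root, or restricting the other forms to the hyperplane Φ = 0 of a
-- form with Φ e₀ = 1 lowers both the dimension and the number of forms by one.
nonzero-common-root : (Φs : List (Vector Bool r → Bool)) → All IsLinear Φs → length Φs < r →
                      NonzeroCommonRoot Φs
nonzero-common-root {ℕ.suc r} Φs lins len with any? (λ Φ → Φ e₀ ≟ᵇ true) Φs
... | no ¬pivot = e₀ , (zero , refl) , All.map ¬-not (¬Any⇒All¬ Φs ¬pivot)
... | yes pivot = lift (nonzero-common-root (map (_∘ embed) rest) rest-isLinear rest-length)
  where
    open Hyperplane (proj₁ (All.lookupAny lins pivot)) (proj₂ (All.lookupAny lins pivot))
    rest = Φs ─ pivot

    rest-isLinear : All IsLinear (map (_∘ embed) rest)
    rest-isLinear = map⁺ (All.map (λ lin → ∘-isLinear lin embed-isLinearMap) (─⁺ pivot lins))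

    rest-length : length (map (_∘ embed) rest) < r
    rest-length = subst (_< r) (sym (length-map (_∘ embed) rest))
                    (s<s⁻¹ (subst (_< ℕ.suc r) (length-removeAt′ Φs (Any.index pivot)) len))

    lift : NonzeroCommonRoot (map (_∘ embed) rest) → NonzeroCommonRoot Φs
    lift (t , (k , tk) , roots) = embed t , (suc k , tk) , ─⁻ pivot (Φ∘embed≡false t) (map⁻ roots)

module _ {n : ℕ} (a b : Fin n) (w : Bool) (f : Assignment (OVar n)) where

  evalLin-lit-∉ : ∀ vs → (a , b) ∉ vs → evalLin vs (coeff (lit a b w)) f ≡ false
  evalLin-lit-∉ []       _   = refl
  evalLin-lit-∉ (p ∷ vs) ab∉ with ≡-dec _≟_ _≟_ p (a , b)
  ... | yes p≡ab = contradiction (here (sym p≡ab)) ab∉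
  ... | no  _    = evalLin-lit-∉ vs (ab∉ ∘ there)

  evalLin-lit-∈ : ∀ vs → Unique vs → (a , b) ∈ vs → evalLin vs (coeff (lit a b w)) f ≡ f (a , b)
  evalLin-lit-∈ (p ∷ vs) uniq ab∈ with ≡-dec _≟_ _≟_ p (a , b) | ab∈
  ... | yes refl | _ = trans (cong (f p xor_) (evalLin-lit-∉ vs (Unique[x∷xs]⇒x∉xs uniq)))
                             (xor-identityʳ (f p))
  ... | no p≢ab | here ab≡p  = contradiction (sym ab≡p) p≢ab
  ... | no _    | there ab∈′ = evalLin-lit-∈ vs (AllPairs.tail uniq) ab∈′

offDiag-unique : ∀ n → Unique (offDiag n)
offDiag-unique n = filter⁺ _ (cartesianProduct⁺ (allFin⁺ n) (allFin⁺ n))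

∈-offDiag : {a b : Fin n} → a ≢ b → (a , b) ∈ offDiag n
∈-offDiag {a = a} {b} a≢b = ∈-filter⁺ _ (∈-cartesianProduct⁺ (∈-allFin a) (∈-allFin b)) a≢b

evalLin-lit : {a b : Fin n} {w : Bool} (f : Assignment (OVar n)) → a ≢ b →
              evalLin (offDiag n) (coeff (lit a b w)) f ≡ f (a , b)
evalLin-lit {n} {a} {b} {w} f a≢b =
  evalLin-lit-∈ a b w f (offDiag n) (offDiag-unique n) (∈-offDiag a≢b)

module _ {a b : Fin n} {w : Bool} {f : Assignment (OVar n)} (a≢b : a ≢ b) where

  SatEq-lit⁺ : f (a , b) ≡ w → SatEq (offDiag n) f (lit a b w)
  SatEq-lit⁺ = trans (evalLin-lit {w = w} f a≢b)

  SatEq-lit⁻ : SatEq (offDiag n) f (lit a b w) → f (a , b) ≡ w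
  SatEq-lit⁻ = trans (sym (evalLin-lit {w = w} f a≢b))

NM⁺ : {k i : Fin n} {f : Assignment (OVar n)} → k ≢ i → f (k , i) ≡ true →
      SatClause (offDiag n) f (NM i)
NM⁺ {k = k} {i} k≢i fki =
  lose (∈-map⁺ (λ j → pos j i) (∈-filter⁺ _ (∈-allFin k) k≢i)) (SatEq-lit⁺ k≢i fki)

SolvesSystem-⊕ : {vs : List V} {α δ : Assignment V} {S : LinSystem V} →
                 SolvesSystem vs α S → All (λ e → evalLin vs (coeff e) δ ≡ false) S →
                 SolvesSystem vs (α ⊕ δ) S
SolvesSystem-⊕ []                 []            = []
SolvesSystem-⊕ {vs = vs} {α} {δ} {e ∷ _} (αe ∷ αS) (δe ∷ δS) =
  trans (IsLinear.homo (evalLin-isLinear vs (coeff e)) α δ)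
        (trans (cong₂ _xor_ αe δe) (xor-identityʳ (rhs e)))
  ∷ SolvesSystem-⊕ {vs = vs} {α} {δ} αS δS

-- R (a , b) ≡ true reads "a precedes b"; only pairs of distinct elements are constrained.
record IsStrictTotal (R : Assignment (OVar n)) : Set where
  field
    converse   : {a b : Fin n} → a ≢ b → R (b , a) ≡ not (R (a , b))
    transitive : {a b c : Fin n} → a ≢ b → b ≢ c → a ≢ c →
                 R (a , b) ≡ true → R (b , c) ≡ true → R (a , c) ≡ true

proper⇒isStrictTotal : {R : Assignment (OVar n)} → Proper (offDiag n) (ORDER n) R → IsStrictTotal R
proper⇒isStrictTotal {R = R} proper = record { converse = converse ; transitive = transitive }
  where
    converse : ∀ {a b} → a ≢ b → R (b , a) ≡ not (R (a , b))
    converse {a} {b} a≢b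
      with R (a , b) in Rab | proper _ (antisym a b a≢b) | proper _ (total a b a≢b)
    ... | true  | here s         | _              = contradiction (trans (sym Rab) (SatEq-lit⁻ a≢b s)) λ ()
    ... | true  | there (here s) | _              = SatEq-lit⁻ (≢-sym a≢b) s
    ... | false | _              | here s         = contradiction (trans (sym Rab) (SatEq-lit⁻ a≢b s)) λ ()
    ... | false | _              | there (here s) = SatEq-lit⁻ (≢-sym a≢b) s

    transitive : ∀ {a b c} → a ≢ b → b ≢ c → a ≢ c →
                 R (a , b) ≡ true → R (b , c) ≡ true → R (a , c) ≡ true
    transitive {a} {b} {c} a≢b b≢c a≢c Rab Rbc with proper _ (transitivity a b c a≢b b≢c a≢c)
    ... | here s                 = contradiction (trans (sym Rab) (SatEq-lit⁻ a≢b s)) λ ()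
    ... | there (here s)         = contradiction (trans (sym Rbc) (SatEq-lit⁻ b≢c s)) λ ()
    ... | there (there (here s)) = SatEq-lit⁻ a≢c s

isStrictTotal⇒proper : {R : Assignment (OVar n)} → IsStrictTotal R → Proper (offDiag n) (ORDER n) R
isStrictTotal⇒proper {n} {R} strictTotal = proper
  where
    open IsStrictTotal strictTotal

    converse-sat : ∀ {a b w} → a ≢ b → R (a , b) ≡ not w → SatEq (offDiag n) R (lit b a w)
    converse-sat {a} {b} {w} a≢b Rab =
      SatEq-lit⁺ (≢-sym a≢b) (trans (converse a≢b) (trans (cong not Rab) (not-involutive w)))

    proper : Proper (offDiag n) (ORDER n) R
    proper _ (antisym a b a≢b) with R (a , b) in Rab
    ... | false = here (SatEq-lit⁺ a≢b Rab)
    ... | true  = there (here (converse-sat a≢b Rab))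
    proper _ (total a b a≢b) with R (a , b) in Rab
    ... | true  = here (SatEq-lit⁺ a≢b Rab)
    ... | false = there (here (converse-sat a≢b Rab))
    proper _ (transitivity a b c a≢b b≢c a≢c) with R (a , b) in Rab | R (b , c) in Rbc
    ... | false | _     = here (SatEq-lit⁺ a≢b Rab)
    ... | true  | false = there (here (SatEq-lit⁺ b≢c Rbc))
    ... | true  | true  = there (there (here (SatEq-lit⁺ a≢c (transitive a≢b b≢c a≢c Rab Rbc))))

later : Assignment (OVar n) → OVar n → Fin n
later R (a , b) = if R (a , b) then b else a

promote : Assignment (OVar n) → (Fin n → Bool) → Assignment (OVar n)
promote R t = R ⊕ (t ∘ later R)

module Promote {R : Assignment (OVar n)} (t : Fin n → Bool) where

  promote-marked-unmarked : {a b : Fin n} → t a ≡ true → t b ≡ false → promote R t (a , b) ≡ true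
  promote-marked-unmarked {a} {b} ta tb with R (a , b)
  ... | true  = cong (true xor_) tb
  ... | false = ta

  promote-unmarked-marked : {a b : Fin n} → t a ≡ false → t b ≡ true → promote R t (a , b) ≡ false
  promote-unmarked-marked {a} {b} ta tb with R (a , b)
  ... | true  = cong (true xor_) tb
  ... | false = ta

  promote-unmarked-unmarked : {a b : Fin n} → t a ≡ false → t b ≡ false →
                              promote R t (a , b) ≡ R (a , b)
  promote-unmarked-unmarked {a} {b} ta tb with R (a , b)
  ... | true  = cong (true xor_) tb
  ... | false = ta

  module _ (strictTotal : IsStrictTotal R) where
    open IsStrictTotal strictTotal

    later-sym : {a b : Fin n} → a ≢ b → later R (b , a) ≡ later R (a , b)
    later-sym {a} {b} a≢b = trans (cong (if_then a else b) (converse a≢b)) (if-not (R (a , b)))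

    promote-marked-marked : {a b : Fin n} → a ≢ b → t a ≡ true → t b ≡ true →
                            promote R t (a , b) ≡ R (b , a)
    promote-marked-marked {a} {b} a≢b ta tb rewrite converse a≢b with R (a , b)
    ... | true  = cong (true xor_) tb
    ... | false = ta

    promote-converse : {a b : Fin n} → a ≢ b → promote R t (b , a) ≡ not (promote R t (a , b))
    promote-converse {a} {b} a≢b = begin
      R (b , a) xor t (later R (b , a))       ≡⟨ cong₂ _xor_ (converse a≢b) (cong t (later-sym a≢b)) ⟩
      not (R (a , b)) xor t (later R (a , b)) ≡⟨ sym (not-distribˡ-xor (R (a , b)) _) ⟩
      not (promote R t (a , b))               ∎
      where open ≡-Reasoning

    promote-transitive : {a b c : Fin n} → a ≢ b → b ≢ c → a ≢ c → promote R t (a , b) ≡ true →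
                         promote R t (b , c) ≡ true → promote R t (a , c) ≡ true
    promote-transitive {a} {b} {c} a≢b b≢c a≢c Pab Pbc with t a in ta | t b in tb | t c in tc
    ... | false | false | false =
      trans (promote-unmarked-unmarked ta tc)
            (transitive a≢b b≢c a≢c (trans (sym (promote-unmarked-unmarked ta tb)) Pab)
                                    (trans (sym (promote-unmarked-unmarked tb tc)) Pbc))
    ... | true  | true  | true  =
      trans (promote-marked-marked a≢c ta tc)
            (transitive (≢-sym b≢c) (≢-sym a≢b) (≢-sym a≢c)
                        (trans (sym (promote-marked-marked b≢c tb tc)) Pbc)
                        (trans (sym (promote-marked-marked a≢b ta tb)) Pab))
    ... | true  | _     | false = promote-marked-unmarked ta tc
    ... | false | true  | _     = contradiction (trans (sym Pab) (promote-unmarked-marked ta tb)) λ ()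
    ... | _     | false | true  = contradiction (trans (sym Pbc) (promote-unmarked-marked tb tc)) λ ()

    promote-isStrictTotal : IsStrictTotal (promote R t)
    promote-isStrictTotal = record { converse = promote-converse ; transitive = promote-transitive }

open Promote using (promote-marked-unmarked; promote-isStrictTotal)

change : Assignment (OVar n) → LinEq (OVar n) → Vector Bool n → Bool
change {n} α e t = evalLin (offDiag n) (coeff e) (t ∘ later α)

change-isLinear : (α : Assignment (OVar n)) (e : LinEq (OVar n)) → IsLinear (change α e)
change-isLinear {n} α e =
  ∘-isLinear (evalLin-isLinear (offDiag n) (coeff e)) (precompose-isLinearMap (later α))

∃-promotion : (α : Assignment (OVar n)) (S : LinSystem (OVar n)) (i : Fin n) →
              ℕ.suc (length S) < n → SolvesSystem (offDiag n) α S →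
              ∃ λ t → t i ≡ false × (∃ λ k → t k ≡ true) × SolvesSystem (offDiag n) (promote α t) S
∃-promotion {n} α S i len α⊨S
  with t , (k , tk) , ti ∷ roots ← nonzero-common-root ((λ t → t i) ∷ map (change α) S)
         (evaluate-isLinear i ∷ map⁺ (All.universal (change-isLinear α) S))
         (subst (λ m → ℕ.suc m < n) (sym (length-map (change α) S)) len)
  = t , ti , (k , tk) , SolvesSystem-⊕ {vs = offDiag n} {α} {t ∘ later α} α⊨S (map⁻ roots)

<∸2⇒suc< : ∀ {m} n → m < n ∸ 2 → ℕ.suc m < n
<∸2⇒suc< (ℕ.suc (ℕ.suc n)) m<n = s<s (m<n⇒m<1+n m<n)

lemma3p5 : (n : ℕ) → 1 ≤ n → Extensible (offDiag n) (Ordering n) (ORDER n) (n ∸ 2)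
lemma3p5 n _ S len (α , α⊨S , α-proper) C (order C C∈ORDER) C∉ORDER = contradiction C∈ORDER C∉ORDER
lemma3p5 n _ S len (α , α⊨S , α-proper) _ (nonmin i) _
  with t , ti , (k , tk) , β⊨S ← ∃-promotion α S i (<∸2⇒suc< n len) α⊨S
  = promote α t , β⊨S , isStrictTotal⇒proper (promote-isStrictTotal t (proper⇒isStrictTotal α-proper)) ,
    NM⁺ k≢i (promote-marked-unmarked {R = α} t tk ti)
  where
    k≢i : k ≢ i
    k≢i refl = contradiction (trans (sym tk) ti) λ ()
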